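{- Let $r\ge1$, $g\in\mathbb{F}_q[X_1,\dots,X_r]$ and $\beta_1,\dots,\beta_r\in\{1,\dots,r\}$. Then $$g(X_1,\dots,X_r)\operatorname{O}^{(r)}_{\mathfrak{f}}\equiv g(X_{\beta_1},\dots,X_{\beta_r})\operatorname{O}^{(r)}_{\mathfrak{f}}\pmod{(\mathfrak{f}(X_1),\dots,\mathfrak{f}(X_r))}.$$
   Context: Let $\mathbb{F}_q$ be a finite field and $\mathfrak{f}(t)=a_nt^n+\cdots+a_0\in\mathbb{F}_q[t]$ monic of degree $n\ge1$. For a variable $X$, $\operatorname{D}_{\mathfrak{f}}$ is the $\mathbb{F}_q$-linear map on polynomials in $X$ of degree $<n$ with $\operatorname{D}_{\mathfrak{f}}(X^i)=\sum_{j=0}^{n-i-1}a_{i+j+1}X^j$ for $0\le i\le n-1$. Weil operators: $\operatorname{O}^{(1)}_{\mathfrak{f}}(X_1)=1$; $\operatorname{O}^{(2)}_{\mathfrak{f}}(X_1,X_2)=\sum_{k=0}^{n-1}\operatorname{D}_{\mathfrak{f}}(X_1^k)X_2^k$; for $r>2$, $\operatorname{O}^{(r)}_{\mathfrak{f}}=\operatorname{O}^{(r)}_{\mathfrak{f}}(X_1,\dots,X_r)$ is the unique polynomial whose degree in each $X_i$ is $<n$ and which is congruent to $\prod_{j=1}^{r-1}\operatorname{O}^{(2)}_{\mathfrak{f}}(X_j,X_r)$ modulo $\mathfrak{f}(X_r)$. -}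

module Defs where

open import Level using (Level; _⊔_; Lift)
open import Algebra.Bundles using (CommutativeRing)
open import Data.Nat as ℕ using (ℕ; zero; suc; _<ᵇ_; _≡ᵇ_)
import Data.Nat.Properties as ℕP
open import Data.Fin as Fin using (Fin; inject₁; fromℕ; toℕ)
open import Data.Vec as Vec using (Vec; tabulate; zipWith; lookup)
import Data.Vec.Properties as VecP
open import Data.List as List using (List; []; _∷_; concatMap; map; foldr; upTo)
open import Data.Product using (_×_; _,_; Σ; ∃)
open import Data.Bool using (if_then_else_)
open import Data.Empty using (⊥)
open import Relation.Nullary using (¬_; does; yes; no)

record IsFiniteField {c ℓ : Level} (R : CommutativeRing c ℓ) : Set (c ⊔ ℓ) where
  open CommutativeRing R
  field
    0≉1     : ¬ (0# ≈ 1#)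
    inverse : ∀ x → ¬ (x ≈ 0#) → ∃ λ y → x * y ≈ 1#
    size    : ℕ
    enum    : Fin size → Carrier
    surj    : ∀ x → ∃ λ i → enum i ≈ x

-- Multivariate polynomials R[X₀,…,X_{r-1}] as finite formal sums of
-- terms  c · X^e  (e : Vec ℕ r the exponent vector).  Two polynomials
-- are equal (_≈P_) iff all their coefficients agree.

module _ {c ℓ : Level} {R : CommutativeRing c ℓ} where
  open CommutativeRing R renaming (_+_ to _+R_; _*_ to _*R_; -_ to -R_)

  Monomial : ℕ → Set
  Monomial r = Vec ℕ r

  record Poly (r : ℕ) : Set c where
    constructor poly
    field terms : List (Carrier × Monomial r)
  open Poly public

  coeff : ∀ {r} → Poly r → Monomial r → Carrier
  coeff p m = foldr (λ { (a , e) acc → if does (VecP.≡-dec ℕP._≟_ e m) then a +R acc else acc })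
                    0# (terms p)

  _≈P_ : ∀ {r} → Poly r → Poly r → Set ℓ
  p ≈P q = ∀ m → coeff p m ≈ coeff q m

  infix 4 _≈P_
  infixl 6 _+P_ _-P_
  infixl 7 _*P_

  0P : ∀ {r} → Poly r
  0P = poly []

  constP : ∀ {r} → Carrier → Poly r
  constP a = poly ((a , Vec.replicate _ 0) ∷ [])

  1P : ∀ {r} → Poly r
  1P = constP 1#

  _+P_ : ∀ {r} → Poly r → Poly r → Poly r
  p +P q = poly (terms p List.++ terms q)

  -P_ : ∀ {r} → Poly r → Poly r
  -P p = poly (map (λ { (a , e) → (-R a , e) }) (terms p))

  _-P_ : ∀ {r} → Poly r → Poly r → Poly r
  p -P q = p +P (-P q)

  _*P_ : ∀ {r} → Poly r → Poly r → Poly r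
  p *P q = poly (concatMap (λ { (a , e) → map (λ { (b , e′) → (a *R b , zipWith ℕ._+_ e e′) }) (terms q) })
                           (terms p))

  _^P_ : ∀ {r} → Poly r → ℕ → Poly r
  p ^P zero  = 1P
  p ^P suc k = p *P (p ^P k)

  varPow : ∀ {r} → Fin r → ℕ → Poly r
  varPow i k = poly ((1# , tabulate (λ j → if does (i Fin.≟ j) then k else 0)) ∷ [])

  X : ∀ {r} → Fin r → Poly r
  X i = varPow i 1

  Σ< : ∀ {r} → ℕ → (ℕ → Poly r) → Poly r
  Σ< n F = foldr (λ k acc → F k +P acc) 0P (upTo n)

  ΣFin : ∀ {r} k → (Fin k → Poly r) → Poly r
  ΣFin zero    F = 0P
  ΣFin (suc k) F = F Fin.zero +P ΣFin k (λ i → F (Fin.suc i))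

  ∏Fin : ∀ {r} k → (Fin k → Poly r) → Poly r
  ∏Fin zero    F = 1P
  ∏Fin (suc k) F = F Fin.zero *P ∏Fin k (λ i → F (Fin.suc i))

  compose : ∀ {r s} → Poly r → (Fin r → Poly s) → Poly s
  compose {r} g σ =
    foldr (λ { (a , e) acc → (constP a *P ∏Fin r (λ i → σ i ^P lookup e i)) +P acc }) 0P (terms g)

  CongMod : ∀ {r} k → (Fin k → Poly r) → Poly r → Poly r → Set (c ⊔ ℓ)
  CongMod {r} k h p q = ∃ λ (cs : Fin k → Poly r) → p -P q ≈P ΣFin k (λ i → cs i *P h i)

  DegLt : ∀ {r} → Fin r → ℕ → Poly r → Set ℓ
  DegLt i n p = ∀ m → n ℕ.≤ lookup m i → coeff p m ≈ 0#

  -- A monic polynomial 𝔣(t) = t^n + a_{n-1} t^{n-1} + … + a_0 is given by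
  -- n and a : Fin n → Carrier.  fcoef n a i is the coefficient a_i
  -- (so fcoef n a n = 1, and a_i = 0 for i > n).

  fcoef : (n : ℕ) → (Fin n → Carrier) → ℕ → Carrier
  fcoef n a i with i ℕ.<? n
  ... | yes i<n = a (Fin.fromℕ< i<n)
  ... | no  _   = if i ≡ᵇ n then 1# else 0#

  fAt : ∀ {r} (n : ℕ) → (Fin n → Carrier) → Fin r → Poly r
  fAt n a i = Σ< (suc n) (λ k → constP (fcoef n a k) *P varPow i k)

  D𝔣 : ∀ {r} (n : ℕ) → (Fin n → Carrier) → Fin r → ℕ → Poly r
  D𝔣 n a i k = Σ< (n ℕ.∸ k) (λ j → constP (fcoef n a (k ℕ.+ j ℕ.+ 1)) *P varPow i j)

  O2 : ∀ {r} (n : ℕ) → (Fin n → Carrier) → Fin r → Fin r → Poly r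
  O2 n a i j = Σ< n (λ k → D𝔣 n a i k *P varPow j k)

  -- IsWeilOp n a r O : O is the Weil operator O^{(r)}_𝔣(X_1,…,X_r)
  -- (variables X_1,…,X_r are X 0, …, X (r-1) here).
  --   r = 1 : O = 1
  --   r = 2 : O = O^{(2)}_𝔣(X_1,X_2)
  --   r > 2 : O has degree < n in every variable and
  --           O ≡ ∏_{j=1}^{r-1} O^{(2)}_𝔣(X_j,X_r)  (mod 𝔣(X_r)),
  --           which characterises O uniquely.
  IsWeilOp : (n : ℕ) → (Fin n → Carrier) → (r : ℕ) → Poly r → Set (c ⊔ ℓ)
  IsWeilOp n a zero O = Lift (c ⊔ ℓ) ⊥
  IsWeilOp n a (suc zero) O = Lift c (O ≈P 1P)
  IsWeilOp n a (suc (suc zero)) O = Lift c (O ≈P O2 n a Fin.zero (Fin.suc Fin.zero))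
  IsWeilOp n a (suc (suc (suc r))) O =
    (∀ i → DegLt i n O) ×
    CongMod 1 (λ _ → fAt n a (fromℕ (suc (suc r))))
      O (∏Fin (suc (suc r)) (λ j → O2 n a (inject₁ j) (fromℕ (suc (suc r)))))

{-# OPTIONS --safe #-}
module Submission where

-- Call O balanced if X_i O ≡ X_j O modulo I = (𝔣(X₁), …, 𝔣(X_r)) for all i, j. The difference
-- quotient O⁽²⁾(X_i, X_j) of 𝔣 satisfies (X_i − X_j) O⁽²⁾(X_i, X_j) = 𝔣(X_i) − 𝔣(X_j), so multiplying
-- it by X_i or by X_j agrees modulo I. For r > 2, O⁽ʳ⁾ ≡ ∏_{j<r} O⁽²⁾(X_j, X_r) and each factor lets X_j
-- be traded for X_r, so X_i O⁽ʳ⁾ ≡ X_r O⁽ʳ⁾ for every i: the Weil operator is balanced. Finally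
-- p ~ q :⇔ p O ≡ q O (mod I) is a congruence for + and ·, and X_i ~ X_{β i}, so g ~ g(X_β).

open import Defs
open import Level using (Level; _⊔_; lift)
open import Algebra.Bundles using (CommutativeSemiring; CommutativeRing; CommutativeMonoid)
open import Data.Nat as ℕ using (ℕ; zero; suc; _∸_; _≤_)
import Data.Nat.Properties as ℕP
open import Data.Fin as Fin using (Fin; inject₁; fromℕ)
open import Data.List using ([]; _∷_; map; foldr; upTo)
import Data.List.Properties as ListP
open import Data.Product using (_×_; _,_; ∃)
open import Function using (_∘_)
open import Relation.Binary.PropositionalEquality as ≡ using (_≡_)

module DifferenceQuotient {c ℓ} (S : CommutativeSemiring c ℓ) where
  open CommutativeSemiring S
  open import Algebra.Properties.CommutativeSemigroup *-commutativeSemigroup using (x∙yz≈y∙xz)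
  open import Data.Maybe using (nothing)
  open import Tactic.RingSolver.Core.AlmostCommutativeRing using (fromCommutativeSemiring)
  open import Tactic.RingSolver.NonReflective (fromCommutativeSemiring S (λ _ → nothing))
    using (solve; _⊜_; _⊕_; _⊗_)
  open import Relation.Binary.Reasoning.Setoid setoid

  ∑< : ℕ → (ℕ → Carrier) → Carrier
  ∑< N F = foldr (λ k acc → F k + acc) 0# (upTo N)

  ∑<-suc : ∀ N F → ∑< (suc N) F ≡ F 0 + ∑< N (F ∘ suc)
  ∑<-suc N F = ≡.cong (F 0 +_) (≡.trans (≡.cong (foldr _ 0#) (≡.sym (ListP.map-upTo suc N)))
                                         (ListP.foldr-map _ suc 0# (upTo N)))

  ∑<-cong : ∀ N {F G} → (∀ k → F k ≈ G k) → ∑< N F ≈ ∑< N G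
  ∑<-cong zero    F≈G = refl
  ∑<-cong (suc N) {F} {G} F≈G = begin
    ∑< (suc N) F           ≡⟨ ∑<-suc N F ⟩
    F 0 + ∑< N (F ∘ suc)   ≈⟨ +-cong (F≈G 0) (∑<-cong N (F≈G ∘ suc)) ⟩
    G 0 + ∑< N (G ∘ suc)   ≡⟨ ∑<-suc N G ⟨
    ∑< (suc N) G           ∎

  *-distribˡ-∑< : ∀ N x F → x * ∑< N F ≈ ∑< N (λ k → x * F k)
  *-distribˡ-∑< zero    x F = zeroʳ x
  *-distribˡ-∑< (suc N) x F = begin
    x * ∑< (suc N) F                        ≡⟨ ≡.cong (x *_) (∑<-suc N F) ⟩
    x * (F 0 + ∑< N (F ∘ suc))              ≈⟨ distribˡ x _ _ ⟩
    x * F 0 + x * ∑< N (F ∘ suc)            ≈⟨ +-congˡ (*-distribˡ-∑< N x (F ∘ suc)) ⟩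
    x * F 0 + ∑< N (λ k → x * F (suc k))    ≡⟨ ∑<-suc N (λ k → x * F k) ⟨
    ∑< (suc N) (λ k → x * F k)              ∎

  -- Powers are passed as sequences so that, instantiated with the monomials varPow i, polyVal and
  -- differenceQuotient are definitionally fAt and O2.
  IsPowerSequence : Carrier → (ℕ → Carrier) → Set ℓ
  IsPowerSequence x xᵏ = xᵏ 0 ≈ 1# × (∀ k → xᵏ (suc k) ≈ x * xᵏ k)

  polyVal : (ℕ → Carrier) → ℕ → (ℕ → Carrier) → Carrier
  polyVal κ N xᵏ = ∑< N (λ k → κ k * xᵏ k)

  differenceQuotient : (ℕ → Carrier) → ℕ → (ℕ → Carrier) → (ℕ → Carrier) → Carrier
  differenceQuotient κ N xᵏ yᵏ = ∑< N (λ k → ∑< (N ∸ k) (λ j → κ (k ℕ.+ j ℕ.+ 1) * xᵏ j) * yᵏ k)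

  polyVal-suc : ∀ {x xᵏ} → IsPowerSequence x xᵏ → ∀ κ N →
    polyVal κ (suc N) xᵏ ≈ κ 0 + x * polyVal (κ ∘ suc) N xᵏ
  polyVal-suc {x} {xᵏ} (x⁰≈1 , xᵏ⁺¹≈) κ N = begin
    polyVal κ (suc N) xᵏ
      ≡⟨ ∑<-suc N _ ⟩
    κ 0 * xᵏ 0 + ∑< N (λ k → κ (suc k) * xᵏ (suc k))
      ≈⟨ +-cong (trans (*-congˡ x⁰≈1) (*-identityʳ _)) (∑<-cong N x-out) ⟩
    κ 0 + ∑< N (λ k → x * (κ (suc k) * xᵏ k))
      ≈⟨ +-congˡ (*-distribˡ-∑< N x _) ⟨
    κ 0 + x * polyVal (κ ∘ suc) N xᵏ
      ∎
    where
    x-out : ∀ k → κ (suc k) * xᵏ (suc k) ≈ x * (κ (suc k) * xᵏ k)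
    x-out k = trans (*-congˡ (xᵏ⁺¹≈ k)) (x∙yz≈y∙xz _ x _)

  differenceQuotient-suc : ∀ {y yᵏ} → IsPowerSequence y yᵏ → ∀ κ N xᵏ →
    differenceQuotient κ (suc N) xᵏ yᵏ ≈ polyVal (κ ∘ suc) (suc N) xᵏ + y * differenceQuotient (κ ∘ suc) N xᵏ yᵏ
  differenceQuotient-suc {y} {yᵏ} (y⁰≈1 , yᵏ⁺¹≈) κ N xᵏ = begin
    differenceQuotient κ (suc N) xᵏ yᵏ
      ≡⟨ ∑<-suc N _ ⟩
    ∑< (suc N) (λ j → κ (j ℕ.+ 1) * xᵏ j) * yᵏ 0 + ∑< N (λ k → Dₖ k * yᵏ (suc k))
      ≈⟨ +-cong (trans (*-congˡ y⁰≈1) (trans (*-identityʳ _) (∑<-cong (suc N) j+1≡suc-j))) (∑<-cong N y-out) ⟩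
    polyVal (κ ∘ suc) (suc N) xᵏ + ∑< N (λ k → y * (Dₖ k * yᵏ k))
      ≈⟨ +-congˡ (*-distribˡ-∑< N y _) ⟨
    polyVal (κ ∘ suc) (suc N) xᵏ + y * differenceQuotient (κ ∘ suc) N xᵏ yᵏ
      ∎
    where
    Dₖ : ℕ → Carrier
    Dₖ k = ∑< (N ∸ k) (λ j → κ (suc k ℕ.+ j ℕ.+ 1) * xᵏ j)
    j+1≡suc-j : ∀ j → κ (j ℕ.+ 1) * xᵏ j ≈ κ (suc j) * xᵏ j
    j+1≡suc-j j = *-congʳ (reflexive (≡.cong κ (ℕP.+-comm j 1)))
    y-out : ∀ k → Dₖ k * yᵏ (suc k) ≈ y * (Dₖ k * yᵏ k)
    y-out k = trans (*-congˡ (yᵏ⁺¹≈ k)) (x∙yz≈y∙xz _ y _)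

  -- (x − y) · differenceQuotient = f(x) − f(y), with both sides moved so that no subtraction occurs.
  differenceQuotient-spec : ∀ {x xᵏ y yᵏ} → IsPowerSequence x xᵏ → IsPowerSequence y yᵏ → ∀ κ N →
    x * differenceQuotient κ N xᵏ yᵏ + polyVal κ (suc N) yᵏ
      ≈ y * differenceQuotient κ N xᵏ yᵏ + polyVal κ (suc N) xᵏ
  differenceQuotient-spec {x} {_}  {y} (x⁰≈1 , _) (y⁰≈1 , _) κ zero =
    +-cong (trans (zeroʳ x) (sym (zeroʳ y))) (+-congʳ (*-congˡ (trans y⁰≈1 (sym x⁰≈1))))
  differenceQuotient-spec {x} {xᵏ} {y} {yᵏ} xᵏ-pow yᵏ-pow κ (suc N) = begin
    x * differenceQuotient κ (suc N) xᵏ yᵏ + polyVal κ (suc (suc N)) yᵏ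
      ≈⟨ +-cong (*-congˡ (differenceQuotient-suc yᵏ-pow κ N xᵏ)) (polyVal-suc yᵏ-pow κ (suc N)) ⟩
    x * (A + y * T) + (κ 0 + y * B)
      ≈⟨ solve 6 (λ x y A B T κ₀ → (x ⊗ (A ⊕ y ⊗ T) ⊕ (κ₀ ⊕ y ⊗ B))
                                 ⊜ ((x ⊗ A ⊕ κ₀) ⊕ y ⊗ (x ⊗ T ⊕ B))) refl x y A B T (κ 0) ⟩
    (x * A + κ 0) + y * (x * T + B)
      ≈⟨ +-congˡ (*-congˡ (differenceQuotient-spec xᵏ-pow yᵏ-pow (κ ∘ suc) N)) ⟩
    (x * A + κ 0) + y * (y * T + A)
      ≈⟨ solve 5 (λ x y A T κ₀ → ((x ⊗ A ⊕ κ₀) ⊕ y ⊗ (y ⊗ T ⊕ A))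
                               ⊜ (y ⊗ (A ⊕ y ⊗ T) ⊕ (κ₀ ⊕ x ⊗ A))) refl x y A T (κ 0) ⟩
    y * (A + y * T) + (κ 0 + x * A)
      ≈⟨ +-cong (*-congˡ (differenceQuotient-suc yᵏ-pow κ N xᵏ)) (polyVal-suc xᵏ-pow κ (suc N)) ⟨
    y * differenceQuotient κ (suc N) xᵏ yᵏ + polyVal κ (suc (suc N)) xᵏ
      ∎
    where
    A B T : Carrier
    A = polyVal (κ ∘ suc) (suc N) xᵏ
    B = polyVal (κ ∘ suc) (suc N) yᵏ
    T = differenceQuotient (κ ∘ suc) N xᵏ yᵏ

module QuotientRing {c ℓ} (R : CommutativeRing c ℓ) {k : ℕ} (h : Fin k → CommutativeRing.Carrier R) where
  open CommutativeRing R
  open import Algebra.Properties.Semiring.Sum semiring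
    using (sum; sum-cong-≋; sum-replicate-zero; ∑-distrib-+; *-distribˡ-sum)
  open import Algebra.Properties.Ring ring using (-1*x≈-x; -0#≈0#; x[y-z]≈xy-xz; [y-z]x≈yx-zx)
  open import Algebra.Properties.AbelianGroup +-abelianGroup using (⁻¹-anti-homo‿-; ⁻¹-∙-comm)
  open import Algebra.Properties.CommutativeSemigroup +-commutativeSemigroup using (interchange)
  open import Data.Bool using (if_then_else_)
  open import Relation.Nullary using (does)
  open import Relation.Binary.Reasoning.Setoid setoid

  InIdeal : Carrier → Set (c ⊔ ℓ)
  InIdeal x = ∃ λ (cs : Fin k → Carrier) → x ≈ sum (λ i → cs i * h i)

  InIdeal-resp : ∀ {x y} → x ≈ y → InIdeal x → InIdeal y
  InIdeal-resp x≈y (cs , x≈∑) = cs , trans (sym x≈y) x≈∑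

  InIdeal-0# : InIdeal 0#
  InIdeal-0# = (λ _ → 0#) , sym (trans (sum-cong-≋ {k} (λ i → zeroˡ (h i))) (sum-replicate-zero k))

  InIdeal-+ : ∀ {x y} → InIdeal x → InIdeal y → InIdeal (x + y)
  InIdeal-+ (cs , x≈) (ds , y≈) = (λ i → cs i + ds i) , (begin
    _ + _                                          ≈⟨ +-cong x≈ y≈ ⟩
    sum (λ i → cs i * h i) + sum (λ i → ds i * h i) ≈⟨ ∑-distrib-+ (λ i → cs i * h i) (λ i → ds i * h i) ⟨
    sum (λ i → cs i * h i + ds i * h i)             ≈⟨ sum-cong-≋ {k} (λ i → distribʳ (h i) (cs i) (ds i)) ⟨
    sum (λ i → (cs i + ds i) * h i)                 ∎)

  InIdeal-* : ∀ y {x} → InIdeal x → InIdeal (y * x)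
  InIdeal-* y (cs , x≈) = (λ i → y * cs i) , (begin
    y * _                           ≈⟨ *-congˡ x≈ ⟩
    y * sum (λ i → cs i * h i)      ≈⟨ *-distribˡ-sum y (λ i → cs i * h i) ⟩
    sum (λ i → y * (cs i * h i))    ≈⟨ sum-cong-≋ {k} (λ i → *-assoc y (cs i) (h i)) ⟨
    sum (λ i → (y * cs i) * h i)    ∎)

  InIdeal-‿ : ∀ {x} → InIdeal x → InIdeal (- x)
  InIdeal-‿ {x} x∈ = InIdeal-resp (-1*x≈-x x) (InIdeal-* (- 1#) x∈)

  InIdeal-generator : ∀ i → InIdeal (h i)
  InIdeal-generator i = (λ j → if does (i Fin.≟ j) then 1# else 0#) , sym (sum-δ i h)
    where
    sum-δ : ∀ {m} (i : Fin m) (v : Fin m → Carrier) →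
            sum (λ j → (if does (i Fin.≟ j) then 1# else 0#) * v j) ≈ v i
    sum-δ {suc m} Fin.zero    v = trans (+-cong (*-identityˡ _) sum0) (+-identityʳ _)
      where
      sum0 : sum (λ j → 0# * v (Fin.suc j)) ≈ 0#
      sum0 = trans (sum-cong-≋ {m} (zeroˡ ∘ v ∘ Fin.suc)) (sum-replicate-zero m)
    sum-δ         (Fin.suc i) v = trans (+-cong (zeroˡ _) (sum-δ i (v ∘ Fin.suc))) (+-identityˡ _)

  [x-y]+[y-z]≈x-z : ∀ x y z → (x - y) + (y - z) ≈ x - z
  [x-y]+[y-z]≈x-z x y z = trans (+-assoc x (- y) (y - z))
    (+-congˡ (trans (sym (+-assoc (- y) y (- z))) (trans (+-congʳ (-‿inverseˡ y)) (+-identityˡ (- z)))))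

  infix 4 _≡ᴵ_
  record _≡ᴵ_ (x y : Carrier) : Set (c ⊔ ℓ) where
    constructor ≡ᴵ-intro
    field difference : InIdeal (x - y)

  ≈⇒≡ᴵ : ∀ {x y} → x ≈ y → x ≡ᴵ y
  ≈⇒≡ᴵ {x} {y} x≈y = ≡ᴵ-intro (InIdeal-resp (sym (trans (+-congʳ x≈y) (-‿inverseʳ y))) InIdeal-0#)

  ≡ᴵ-sym : ∀ {x y} → x ≡ᴵ y → y ≡ᴵ x
  ≡ᴵ-sym {x} {y} (≡ᴵ-intro x-y) = ≡ᴵ-intro (InIdeal-resp (⁻¹-anti-homo‿- x y) (InIdeal-‿ x-y))

  ≡ᴵ-trans : ∀ {x y z} → x ≡ᴵ y → y ≡ᴵ z → x ≡ᴵ z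
  ≡ᴵ-trans {x} {y} {z} (≡ᴵ-intro x-y) (≡ᴵ-intro y-z) =
    ≡ᴵ-intro (InIdeal-resp ([x-y]+[y-z]≈x-z x y z) (InIdeal-+ x-y y-z))

  ≡ᴵ-+-cong : ∀ {x y u v} → x ≡ᴵ y → u ≡ᴵ v → x + u ≡ᴵ y + v
  ≡ᴵ-+-cong {x} {y} {u} {v} (≡ᴵ-intro x-y) (≡ᴵ-intro u-v) =
    ≡ᴵ-intro (InIdeal-resp (trans (interchange x (- y) u (- v)) (+-congˡ (⁻¹-∙-comm y v))) (InIdeal-+ x-y u-v))

  ≡ᴵ-*-cong : ∀ {x y u v} → x ≡ᴵ y → u ≡ᴵ v → x * u ≡ᴵ y * v
  ≡ᴵ-*-cong {x} {y} {u} {v} (≡ᴵ-intro x-y) (≡ᴵ-intro u-v) =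
    ≡ᴵ-intro (InIdeal-resp xu-yv (InIdeal-+ x-y·u y·u-v))
    where
    x-y·u : InIdeal ((x - y) * u)
    x-y·u = InIdeal-resp (*-comm u (x - y)) (InIdeal-* u x-y)
    y·u-v : InIdeal (y * (u - v))
    y·u-v = InIdeal-* y u-v
    xu-yv : (x - y) * u + y * (u - v) ≈ x * u - y * v
    xu-yv = trans (+-cong ([y-z]x≈yx-zx u x y) (x[y-z]≈xy-xz y u v)) ([x-y]+[y-z]≈x-z (x * u) (y * u) (y * v))

  ≡ᴵ-‿-cong : ∀ {x y} → x ≡ᴵ y → - x ≡ᴵ - y
  ≡ᴵ-‿-cong {x} {y} (≡ᴵ-intro x-y) = ≡ᴵ-intro (InIdeal-resp (sym (⁻¹-∙-comm x (- y))) (InIdeal-‿ x-y))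

  generator≡ᴵ0# : ∀ i → h i ≡ᴵ 0#
  generator≡ᴵ0# i = ≡ᴵ-intro (InIdeal-resp (sym (trans (+-congˡ -0#≈0#) (+-identityʳ (h i)))) (InIdeal-generator i))

  quotientRing : CommutativeRing c (c ⊔ ℓ)
  quotientRing = record
    { Carrier = Carrier ; _≈_ = _≡ᴵ_ ; _+_ = _+_ ; _*_ = _*_ ; -_ = -_ ; 0# = 0# ; 1# = 1#
    ; isCommutativeRing = record
      { isRing = record
        { +-isAbelianGroup = record
          { isGroup = record
            { isMonoid = record
              { isSemigroup = record
                { isMagma = record
                  { isEquivalence = record { refl = ≈⇒≡ᴵ refl ; sym = ≡ᴵ-sym ; trans = ≡ᴵ-trans }
                  ; ∙-cong = ≡ᴵ-+-cong }
                ; assoc = λ x y z → ≈⇒≡ᴵ (+-assoc x y z) }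
              ; identity = ≈⇒≡ᴵ ∘ +-identityˡ , ≈⇒≡ᴵ ∘ +-identityʳ }
            ; inverse = ≈⇒≡ᴵ ∘ -‿inverseˡ , ≈⇒≡ᴵ ∘ -‿inverseʳ
            ; ⁻¹-cong = ≡ᴵ-‿-cong }
          ; comm = λ x y → ≈⇒≡ᴵ (+-comm x y) }
        ; *-cong = ≡ᴵ-*-cong
        ; *-assoc = λ x y z → ≈⇒≡ᴵ (*-assoc x y z)
        ; *-identity = ≈⇒≡ᴵ ∘ *-identityˡ , ≈⇒≡ᴵ ∘ *-identityʳ
        ; distrib = (λ x y z → ≈⇒≡ᴵ (distribˡ x y z)) , (λ x y z → ≈⇒≡ᴵ (distribʳ x y z)) }
      ; *-comm = λ x y → ≈⇒≡ᴵ (*-comm x y) } }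

module Multiplier {c ℓ} (S : CommutativeSemiring c ℓ) where
  open CommutativeSemiring S
  open import Algebra.Properties.CommutativeMonoid.Sum *-commutativeMonoid public using ()
    renaming (sum to ∏)
  open import Algebra.Properties.CommutativeMonoid.Sum *-commutativeMonoid using ()
    renaming (sum-remove to ∏-remove)
  open import Algebra.Properties.CommutativeSemigroup *-commutativeSemigroup using (x∙yz≈y∙xz)
  open import Data.Vec.Functional using (removeAt)
  open import Relation.Binary.Reasoning.Setoid setoid

  infix 4 _≈[_]_
  _≈[_]_ : Carrier → Carrier → Carrier → Set ℓ
  p ≈[ o ] q = p * o ≈ q * o

  ≈[]-+-cong : ∀ o {p q p′ q′} → p ≈[ o ] q → p′ ≈[ o ] q′ → p + p′ ≈[ o ] q + q′
  ≈[]-+-cong o p≈q p′≈q′ = trans (distribʳ o _ _) (trans (+-cong p≈q p′≈q′) (sym (distribʳ o _ _)))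

  ≈[]-*-cong : ∀ o {p q p′ q′} → p ≈[ o ] q → p′ ≈[ o ] q′ → p * p′ ≈[ o ] q * q′
  ≈[]-*-cong o {p} {q} {p′} {q′} p≈q p′≈q′ = begin
    (p * p′) * o   ≈⟨ *-assoc p p′ o ⟩
    p * (p′ * o)   ≈⟨ *-congˡ p′≈q′ ⟩
    p * (q′ * o)   ≈⟨ x∙yz≈y∙xz p q′ o ⟩
    q′ * (p * o)   ≈⟨ *-congˡ p≈q ⟩
    q′ * (q * o)   ≈⟨ x∙yz≈y∙xz q′ q o ⟩
    q * (q′ * o)   ≈⟨ *-assoc q q′ o ⟨
    (q * q′) * o   ∎

  ≈[]-∏ : ∀ {k} (u : Fin k → Carrier) z (F : Fin k → Carrier) →
          (∀ j → u j ≈[ F j ] z) → ∀ j → u j ≈[ ∏ F ] z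
  ≈[]-∏ {suc k} u z F uF≈zF j = begin
    u j * ∏ F                         ≈⟨ *-congˡ (∏-remove F) ⟩
    u j * (F j * ∏ (removeAt F j))    ≈⟨ *-assoc (u j) (F j) _ ⟨
    (u j * F j) * ∏ (removeAt F j)    ≈⟨ *-congʳ (uF≈zF j) ⟩
    (z * F j) * ∏ (removeAt F j)      ≈⟨ *-assoc z (F j) _ ⟩
    z * (F j * ∏ (removeAt F j))      ≈⟨ *-congˡ (∏-remove F) ⟨
    z * ∏ F                           ∎

  Balanced : ∀ {r} → (Fin r → Carrier) → Carrier → Set ℓ
  Balanced x o = ∀ i j → x i ≈[ o ] x j

  Balanced-intro : ∀ {r} (x : Fin r → Carrier) o z → (∀ i → x i ≈[ o ] z) → Balanced x o
  Balanced-intro x o z x≈z i j = trans (x≈z i) (sym (x≈z j))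

  Balanced-resp : ∀ {r} (x : Fin r → Carrier) {o o′} → o ≈ o′ → Balanced x o → Balanced x o′
  Balanced-resp x o≈o′ bal i j = trans (*-congˡ (sym o≈o′)) (trans (bal i j) (*-congˡ o≈o′))

module PolynomialRing {c ℓ} (R : CommutativeRing c ℓ) where
  open CommutativeRing R
  open import Data.Vec as Vec using (Vec; zipWith; tabulate)
  import Data.Vec.Properties as VecP
  open import Data.Empty using (⊥-elim)
  open import Relation.Nullary using (Dec; yes; no; ¬_; does)
  open import Relation.Binary.Core using (Rel)
  open import Relation.Binary.Definitions using (Reflexive)
  open import Algebra.Definitions using (Congruent₂)
  open import Data.Bool using (true; false; if_then_else_)
  import Data.Bool.Properties as BoolP
  open import Algebra.Properties.Ring ring using (-0#≈0#; -‿+-comm)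

  private
    variable
      r : ℕ
    Pol : ℕ → Set c
    Pol = Poly {R = R}
    Term : ℕ → Set c
    Term r = Carrier × Vec ℕ r

  infixl 6 _⊞_
  _⊞_ : Vec ℕ r → Vec ℕ r → Vec ℕ r
  _⊞_ = zipWith ℕ._+_

  _⊟_ : Vec ℕ r → Vec ℕ r → Vec ℕ r
  _⊟_ = zipWith ℕ._∸_

  ⊞-⊟-cancel : ∀ (e u : Vec ℕ r) → (e ⊞ u) ⊟ e ≡ u
  ⊞-⊟-cancel Vec.[]       Vec.[]       = ≡.refl
  ⊞-⊟-cancel (x Vec.∷ e) (y Vec.∷ u) = ≡.cong₂ Vec._∷_ (ℕP.m+n∸m≡n x y) (⊞-⊟-cancel e u)

  ⊞-cancelˡ : ∀ (e : Vec ℕ r) {u v} → e ⊞ u ≡ e ⊞ v → u ≡ v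
  ⊞-cancelˡ e {u} {v} eq = ≡.trans (≡.sym (⊞-⊟-cancel e u)) (≡.trans (≡.cong (_⊟ e) eq) (⊞-⊟-cancel e v))

  divides? : ∀ (e m : Vec ℕ r) → Dec (∃ λ m′ → e ⊞ m′ ≡ m)
  divides? e m with VecP.≡-dec ℕP._≟_ (e ⊞ (m ⊟ e)) m
  ... | yes eq = yes (m ⊟ e , eq)
  ... | no ¬eq = no λ { (m′ , ≡.refl) → ¬eq (≡.cong (e ⊞_) (⊞-⊟-cancel e m′)) }

  term : Term r → Pol r
  term t = poly (t ∷ [])

  infix 4 _≃_
  record _≃_ (p q : Pol r) : Set ℓ where
    constructor ≈P⇒≃
    field ≃⇒≈P : p ≈P q
  open _≃_ public

  ≃-refl : {p : Pol r} → p ≃ p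
  ≃-refl = ≈P⇒≃ λ _ → refl

  ≃-sym : {p q : Pol r} → p ≃ q → q ≃ p
  ≃-sym (≈P⇒≃ p≈q) = ≈P⇒≃ λ m → sym (p≈q m)

  ≃-trans : {p q s : Pol r} → p ≃ q → q ≃ s → p ≃ s
  ≃-trans (≈P⇒≃ p≈q) (≈P⇒≃ q≈s) = ≈P⇒≃ λ m → trans (p≈q m) (q≈s m)

  ≡⇒≃ : {p q : Pol r} → p ≡ q → p ≃ q
  ≡⇒≃ ≡.refl = ≃-refl

  coeff-+P : ∀ (p q : Pol r) m → coeff (p +P q) m ≈ coeff p m + coeff q m
  coeff-+P (poly [])             q m = sym (+-identityˡ _)
  coeff-+P (poly ((a , e) ∷ ts)) q m with VecP.≡-dec ℕP._≟_ e m
  ... | yes _ = trans (+-congˡ (coeff-+P (poly ts) q m)) (sym (+-assoc _ _ _))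
  ... | no  _ = coeff-+P (poly ts) q m

  coeff--P : ∀ (p : Pol r) m → coeff (-P p) m ≈ - coeff p m
  coeff--P (poly [])             m = sym -0#≈0#
  coeff--P (poly ((a , e) ∷ ts)) m with VecP.≡-dec ℕP._≟_ e m
  ... | yes _ = trans (+-congˡ (coeff--P (poly ts) m)) (-‿+-comm a _)
  ... | no  _ = coeff--P (poly ts) m

  -- poly (t ∷ ts) *P q reduces to t ⊛ q +P poly ts *P q, so the ring laws go by induction on terms.
  infixr 7 _⊛_
  _⊛_ : Term r → Pol r → Pol r
  (a , e) ⊛ q = poly (map (λ (b , e′) → (a * b , e ⊞ e′)) (terms q))

  coeff-⊛-⊞ : ∀ a e (q : Pol r) m → coeff ((a , e) ⊛ q) (e ⊞ m) ≈ a * coeff q m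
  coeff-⊛-⊞ a e (poly [])              m = sym (zeroʳ a)
  coeff-⊛-⊞ a e (poly ((b , e′) ∷ ts)) m with VecP.≡-dec ℕP._≟_ (e ⊞ e′) (e ⊞ m) | VecP.≡-dec ℕP._≟_ e′ m
  ... | yes _  | yes _    = trans (+-congˡ (coeff-⊛-⊞ a e (poly ts) m)) (sym (distribˡ a b _))
  ... | no  _  | no  _    = coeff-⊛-⊞ a e (poly ts) m
  ... | yes eq | no  e′≢m = ⊥-elim (e′≢m (⊞-cancelˡ e eq))
  ... | no  ne | yes e′≡m = ⊥-elim (ne (≡.cong (e ⊞_) e′≡m))

  coeff-⊛-∤ : ∀ a e (q : Pol r) m → ¬ (∃ λ m′ → e ⊞ m′ ≡ m) → coeff ((a , e) ⊛ q) m ≈ 0#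
  coeff-⊛-∤ a e (poly [])              m e∤m = refl
  coeff-⊛-∤ a e (poly ((b , e′) ∷ ts)) m e∤m with VecP.≡-dec ℕP._≟_ (e ⊞ e′) m
  ... | yes eq = ⊥-elim (e∤m (e′ , eq))
  ... | no  _  = coeff-⊛-∤ a e (poly ts) m e∤m

  ⊛-congˡ : ∀ (t : Term r) {q q′} → q ≃ q′ → t ⊛ q ≃ t ⊛ q′
  ⊛-congˡ (a , e) {q} {q′} (≈P⇒≃ q≈q′) = ≈P⇒≃ coeffs
    where
    coeffs : ∀ m → coeff ((a , e) ⊛ q) m ≈ coeff ((a , e) ⊛ q′) m
    coeffs m with divides? e m
    ... | yes (m′ , ≡.refl) =
      trans (coeff-⊛-⊞ a e q m′) (trans (*-congˡ (q≈q′ m′)) (sym (coeff-⊛-⊞ a e q′ m′)))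
    ... | no  e∤m           = trans (coeff-⊛-∤ a e q m e∤m) (sym (coeff-⊛-∤ a e q′ m e∤m))

  term-cong : ∀ {a b} {e e′ : Vec ℕ r} → a ≈ b → e ≡ e′ → term (a , e) ≃ term (b , e′)
  term-cong {a = a} {b} {e} a≈b ≡.refl = ≈P⇒≃ coeffs
    where
    coeffs : ∀ m → coeff (term (a , e)) m ≈ coeff (term (b , e)) m
    coeffs m with VecP.≡-dec ℕP._≟_ e m
    ... | yes _ = +-congʳ a≈b
    ... | no  _ = refl

  +P-cong : {p p′ q q′ : Pol r} → p ≃ p′ → q ≃ q′ → p +P q ≃ p′ +P q′
  +P-cong {p = p} {p′} {q} {q′} (≈P⇒≃ p≈p′) (≈P⇒≃ q≈q′) = ≈P⇒≃ λ m →
    trans (coeff-+P p q m) (trans (+-cong (p≈p′ m) (q≈q′ m)) (sym (coeff-+P p′ q′ m)))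

  +P-assoc : (p q s : Pol r) → (p +P q) +P s ≡ p +P (q +P s)
  +P-assoc p q s = ≡.cong poly (ListP.++-assoc (terms p) (terms q) (terms s))

  +P-comm : (p q : Pol r) → p +P q ≃ q +P p
  +P-comm p q = ≈P⇒≃ λ m → trans (coeff-+P p q m) (trans (+-comm _ _) (sym (coeff-+P q p m)))

  +P-identityʳ : (p : Pol r) → p +P 0P ≡ p
  +P-identityʳ p = ≡.cong poly (ListP.++-identityʳ (terms p))

  -P-inverseˡ : (p : Pol r) → -P p +P p ≃ 0P
  -P-inverseˡ p = ≈P⇒≃ λ m → trans (coeff-+P (-P p) p m) (trans (+-congʳ (coeff--P p m)) (-‿inverseˡ _))

  -P-cong : {p q : Pol r} → p ≃ q → -P p ≃ -P q
  -P-cong {p = p} {q} (≈P⇒≃ p≈q) = ≈P⇒≃ λ m →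
    trans (coeff--P p m) (trans (-‿cong (p≈q m)) (sym (coeff--P q m)))

  +P-commutativeMonoid : ℕ → CommutativeMonoid c ℓ
  +P-commutativeMonoid r = record
    { Carrier = Pol r ; _≈_ = _≃_ ; _∙_ = _+P_ ; ε = 0P
    ; isCommutativeMonoid = record
      { isMonoid = record
        { isSemigroup = record
          { isMagma = record
            { isEquivalence = record { refl = ≃-refl ; sym = ≃-sym ; trans = ≃-trans }
            ; ∙-cong = +P-cong }
          ; assoc = λ p q s → ≡⇒≃ (+P-assoc p q s) }
        ; identity = (λ _ → ≃-refl) , (λ p → ≡⇒≃ (+P-identityʳ p)) }
      ; comm = +P-comm } }

  ⊛-+P : ∀ (t : Term r) q s → t ⊛ (q +P s) ≡ t ⊛ q +P t ⊛ s
  ⊛-+P t q s = ≡.cong poly (ListP.map-++ _ (terms q) (terms s))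

  *P-zeroʳ : (p : Pol r) → p *P 0P ≡ 0P
  *P-zeroʳ (poly [])       = ≡.refl
  *P-zeroʳ (poly (_ ∷ ts)) = *P-zeroʳ (poly ts)

  *P-congʳ : (p : Pol r) {q q′ : Pol r} → q ≃ q′ → p *P q ≃ p *P q′
  *P-congʳ (poly [])       q≃q′ = ≃-refl
  *P-congʳ (poly (t ∷ ts)) q≃q′ = +P-cong (⊛-congˡ t q≃q′) (*P-congʳ (poly ts) q≃q′)

  module ≃-Reasoning {r : ℕ} where
    open import Relation.Binary.Reasoning.Setoid (CommutativeMonoid.setoid (+P-commutativeMonoid r)) public

  *P-distribˡ : (p q s : Pol r) → p *P (q +P s) ≃ p *P q +P p *P s
  *P-distribˡ (poly [])       q s = ≃-refl
  *P-distribˡ (poly (t ∷ ts)) q s = begin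
    t ⊛ (q +P s) +P ts′ *P (q +P s)
      ≡⟨ ≡.cong (_+P ts′ *P (q +P s)) (⊛-+P t q s) ⟩
    (t ⊛ q +P t ⊛ s) +P ts′ *P (q +P s)
      ≈⟨ +P-cong ≃-refl (*P-distribˡ (poly ts) q s) ⟩
    (t ⊛ q +P t ⊛ s) +P (ts′ *P q +P ts′ *P s)
      ≈⟨ interchange (t ⊛ q) (t ⊛ s) (ts′ *P q) (ts′ *P s) ⟩
    (t ⊛ q +P ts′ *P q) +P (t ⊛ s +P ts′ *P s)
      ∎
    where
    open ≃-Reasoning
    open import Algebra.Properties.CommutativeSemigroup
      (CommutativeMonoid.commutativeSemigroup (+P-commutativeMonoid _)) using (interchange)
    ts′ : Pol _
    ts′ = poly ts

  *P-distribʳ : (p q s : Pol r) → (p +P q) *P s ≡ p *P s +P q *P s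
  *P-distribʳ (poly [])       q s = ≡.refl
  *P-distribʳ (poly (t ∷ ts)) q s =
    ≡.trans (≡.cong (t ⊛ s +P_) (*P-distribʳ (poly ts) q s)) (≡.sym (+P-assoc (t ⊛ s) (poly ts *P s) (q *P s)))

  *P-term : (p : Pol r) (t : Term r) → p *P term t ≃ t ⊛ p
  *P-term (poly [])              t       = ≃-refl
  *P-term (poly ((a , e) ∷ ts)) (b , e′) =
    +P-cong (term-cong (*-comm a b) (VecP.zipWith-comm ℕP.+-comm e e′)) (*P-term (poly ts) (b , e′))

  *P-comm : (p q : Pol r) → p *P q ≃ q *P p
  *P-comm (poly [])       q = ≡⇒≃ (≡.sym (*P-zeroʳ q))
  *P-comm (poly (t ∷ ts)) q = begin
    t ⊛ q +P poly ts *P q           ≈⟨ +P-cong (≃-sym (*P-term q t)) (*P-comm (poly ts) q) ⟩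
    q *P term t +P q *P poly ts     ≈⟨ *P-distribˡ q (term t) (poly ts) ⟨
    q *P poly (t ∷ ts)              ∎
    where open ≃-Reasoning

  ⊛-⊛ : ∀ (a b : Carrier) (e e′ : Vec ℕ r) s → (a , e) ⊛ (b , e′) ⊛ s ≃ (a * b , e ⊞ e′) ⊛ s
  ⊛-⊛ a b e e′ (poly [])              = ≃-refl
  ⊛-⊛ a b e e′ (poly ((d , e″) ∷ ts)) =
    +P-cong (term-cong (sym (*-assoc a b d)) (≡.sym (VecP.zipWith-assoc ℕP.+-assoc e e′ e″))) (⊛-⊛ a b e e′ (poly ts))

  ⊛-*P : ∀ (t : Term r) q s → (t ⊛ q) *P s ≃ t ⊛ (q *P s)
  ⊛-*P t         (poly [])              s = ≃-refl
  ⊛-*P (a , e) (poly ((b , e′) ∷ ts)) s = begin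
    (a * b , e ⊞ e′) ⊛ s +P ((a , e) ⊛ poly ts) *P s
      ≈⟨ +P-cong (≃-sym (⊛-⊛ a b e e′ s)) (⊛-*P (a , e) (poly ts) s) ⟩
    (a , e) ⊛ (b , e′) ⊛ s +P (a , e) ⊛ (poly ts *P s)
      ≡⟨ ⊛-+P (a , e) ((b , e′) ⊛ s) (poly ts *P s) ⟨
    (a , e) ⊛ ((b , e′) ⊛ s +P poly ts *P s)
      ∎
    where open ≃-Reasoning

  *P-assoc : (p q s : Pol r) → (p *P q) *P s ≃ p *P (q *P s)
  *P-assoc (poly [])       q s = ≃-refl
  *P-assoc (poly (t ∷ ts)) q s = begin
    (t ⊛ q +P poly ts *P q) *P s            ≡⟨ *P-distribʳ (t ⊛ q) (poly ts *P q) s ⟩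
    (t ⊛ q) *P s +P (poly ts *P q) *P s     ≈⟨ +P-cong (⊛-*P t q s) (*P-assoc (poly ts) q s) ⟩
    t ⊛ (q *P s) +P poly ts *P (q *P s)     ∎
    where open ≃-Reasoning

  ⊛-identityˡ : (p : Pol r) → (1# , Vec.replicate r 0) ⊛ p ≃ p
  ⊛-identityˡ (poly [])             = ≃-refl
  ⊛-identityˡ (poly ((a , e) ∷ ts)) =
    +P-cong (term-cong (*-identityˡ a) (VecP.zipWith-identityˡ (λ _ → ≡.refl) e)) (⊛-identityˡ (poly ts))

  *P-identityˡ : (p : Pol r) → 1P *P p ≃ p
  *P-identityˡ p = ≃-trans (≡⇒≃ (+P-identityʳ _)) (⊛-identityˡ p)

  *P-cong : {p p′ q q′ : Pol r} → p ≃ p′ → q ≃ q′ → p *P q ≃ p′ *P q′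
  *P-cong {p = p} {p′} {q} {q′} p≃p′ q≃q′ = begin
    p *P q     ≈⟨ *P-congʳ p q≃q′ ⟩
    p *P q′    ≈⟨ *P-comm p q′ ⟩
    q′ *P p    ≈⟨ *P-congʳ q′ p≃p′ ⟩
    q′ *P p′   ≈⟨ *P-comm q′ p′ ⟩
    p′ *P q′   ∎
    where open ≃-Reasoning

  polynomialRing : ℕ → CommutativeRing c ℓ
  polynomialRing r = record
    { Carrier = Pol r ; _≈_ = _≃_ ; _+_ = _+P_ ; _*_ = _*P_ ; -_ = -P_ ; 0# = 0P ; 1# = 1P
    ; isCommutativeRing = record
      { isRing = record
        { +-isAbelianGroup = record
          { isGroup = record
            { isMonoid = +P-isMonoid
            ; inverse = -P-inverseˡ , (λ p → ≃-trans (+P-comm p (-P p)) (-P-inverseˡ p))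
            ; ⁻¹-cong = -P-cong }
          ; comm = +P-comm }
        ; *-cong = *P-cong
        ; *-assoc = *P-assoc
        ; *-identity = *P-identityˡ , (λ p → ≃-trans (*P-comm p 1P) (*P-identityˡ p))
        ; distrib = *P-distribˡ , (λ s p q → ≡⇒≃ (*P-distribʳ p q s)) }
      ; *-comm = *P-comm } }
    where open CommutativeMonoid (+P-commutativeMonoid r) using () renaming (isMonoid to +P-isMonoid)

  module _ {s ℓ′} (_∼_ : Rel (Pol s) ℓ′) (∼-refl : Reflexive _∼_)
           (+P-cong∼ : Congruent₂ _∼_ _+P_) (*P-cong∼ : Congruent₂ _∼_ _*P_) where

    ∏Fin-cong : ∀ k {F G : Fin k → Pol s} → (∀ i → F i ∼ G i) → ∏Fin k F ∼ ∏Fin k G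
    ∏Fin-cong zero    F∼G = ∼-refl
    ∏Fin-cong (suc k) F∼G = *P-cong∼ (F∼G Fin.zero) (∏Fin-cong k (F∼G ∘ Fin.suc))

    ^P-cong : ∀ k {p q : Pol s} → p ∼ q → (p ^P k) ∼ (q ^P k)
    ^P-cong zero    p∼q = ∼-refl
    ^P-cong (suc k) p∼q = *P-cong∼ p∼q (^P-cong k p∼q)

    compose-cong : ∀ {r} (g : Pol r) {σ τ : Fin r → Pol s} → (∀ i → σ i ∼ τ i) → compose g σ ∼ compose g τ
    compose-cong (poly [])             σ∼τ = ∼-refl
    compose-cong (poly ((a , e) ∷ ts)) σ∼τ =
      +P-cong∼ (*P-cong∼ (∼-refl {constP a}) (∏Fin-cong _ (λ i → ^P-cong (Vec.lookup e i) (σ∼τ i))))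
               (compose-cong (poly ts) σ∼τ)

  varExp : Fin r → ℕ → Vec ℕ r
  varExp i k = tabulate (λ j → if does (i Fin.≟ j) then k else 0)

  tabulate-const : ∀ n (x : ℕ) → tabulate {n = n} (λ _ → x) ≡ Vec.replicate n x
  tabulate-const zero    x = ≡.refl
  tabulate-const (suc n) x = ≡.cong (x Vec.∷_) (tabulate-const n x)

  tabulate-⊞ : ∀ {n} (g h : Fin n → ℕ) → tabulate g ⊞ tabulate h ≡ tabulate (λ j → g j ℕ.+ h j)
  tabulate-⊞ {zero}  g h = ≡.refl
  tabulate-⊞ {suc n} g h = ≡.cong (g Fin.zero ℕ.+ h Fin.zero Vec.∷_) (tabulate-⊞ (g ∘ Fin.suc) (h ∘ Fin.suc))

  varExp-zero : (i : Fin r) → varExp i 0 ≡ Vec.replicate r 0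
  varExp-zero i = ≡.trans (VecP.tabulate-cong (λ j → BoolP.if-eta (does (i Fin.≟ j)))) (tabulate-const _ 0)

  varExp-suc : ∀ (i : Fin r) k → varExp i 1 ⊞ varExp i k ≡ varExp i (suc k)
  varExp-suc i k = ≡.trans (tabulate-⊞ _ _) (VecP.tabulate-cong (λ j → if-+ (does (i Fin.≟ j))))
    where
    if-+ : ∀ b → (if b then 1 else 0) ℕ.+ (if b then k else 0) ≡ (if b then suc k else 0)
    if-+ false = ≡.refl
    if-+ true  = ≡.refl

  expSum : ∀ {k} → (Fin k → Vec ℕ r) → Vec ℕ r
  expSum {k = zero}  w = Vec.replicate _ 0
  expSum {k = suc k} w = w Fin.zero ⊞ expSum (w ∘ Fin.suc)

  expSum-0∷ : ∀ {k} (w : Fin k → Vec ℕ r) → expSum (λ i → 0 Vec.∷ w i) ≡ 0 Vec.∷ expSum w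
  expSum-0∷ {k = zero}  w = ≡.refl
  expSum-0∷ {k = suc k} w = ≡.cong (λ v → (0 Vec.∷ w Fin.zero) ⊞ v) (expSum-0∷ (w ∘ Fin.suc))

  expSum-varExp : (e : Vec ℕ r) → expSum (λ i → varExp i (Vec.lookup e i)) ≡ e
  expSum-varExp Vec.[]       = ≡.refl
  expSum-varExp {suc r} (x Vec.∷ e) = begin
    (x Vec.∷ tabulate (λ _ → 0)) ⊞ expSum (λ i → 0 Vec.∷ varExp i (Vec.lookup e i))
      ≡⟨ ≡.cong ((x Vec.∷ tabulate (λ _ → 0)) ⊞_) (expSum-0∷ (λ i → varExp i (Vec.lookup e i))) ⟩
    (x ℕ.+ 0) Vec.∷ (tabulate (λ _ → 0) ⊞ expSum (λ i → varExp i (Vec.lookup e i)))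
      ≡⟨ ≡.cong₂ Vec._∷_ (ℕP.+-identityʳ x) (≡.cong₂ _⊞_ (tabulate-const r 0) (expSum-varExp e)) ⟩
    x Vec.∷ (Vec.replicate r 0 ⊞ e)
      ≡⟨ ≡.cong (x Vec.∷_) (VecP.zipWith-identityˡ ℕP.+-identityˡ e) ⟩
    x Vec.∷ e
      ∎
    where open ≡.≡-Reasoning

  varPow-zero : (i : Fin r) → varPow i 0 ≃ 1P
  varPow-zero i = term-cong refl (varExp-zero i)

  varPow-suc : ∀ (i : Fin r) k → varPow i (suc k) ≃ X i *P varPow i k
  varPow-suc i k = term-cong (sym (*-identityˡ 1#)) (≡.sym (varExp-suc i k))

  ^P-varPow : ∀ (i : Fin r) k → X i ^P k ≃ varPow i k
  ^P-varPow i zero    = ≃-sym (varPow-zero i)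
  ^P-varPow i (suc k) = ≃-trans (*P-congʳ (X i) (^P-varPow i k)) (≃-sym (varPow-suc i k))

  ∏Fin-term : ∀ k (w : Fin k → Vec ℕ r) → ∏Fin k (λ i → term (1# , w i)) ≃ term (1# , expSum w)
  ∏Fin-term zero    w = ≃-refl
  ∏Fin-term (suc k) w = ≃-trans (*P-congʳ (term (1# , w Fin.zero)) (∏Fin-term k (w ∘ Fin.suc)))
                                (term-cong (*-identityˡ 1#) ≡.refl)

  ∏Fin-^P : (e : Vec ℕ r) → ∏Fin r (λ i → X i ^P Vec.lookup e i) ≃ term (1# , e)
  ∏Fin-^P {r} e = begin
    ∏Fin r (λ i → X i ^P Vec.lookup e i)
      ≈⟨ ∏Fin-cong _≃_ ≃-refl +P-cong *P-cong r (λ i → ^P-varPow i (Vec.lookup e i)) ⟩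
    ∏Fin r (λ i → term (1# , varExp i (Vec.lookup e i)))
      ≈⟨ ∏Fin-term r (λ i → varExp i (Vec.lookup e i)) ⟩
    term (1# , expSum (λ i → varExp i (Vec.lookup e i)))
      ≡⟨ ≡.cong (λ e′ → term (1# , e′)) (expSum-varExp e) ⟩
    term (1# , e)
      ∎
    where open ≃-Reasoning

  compose-X : (g : Pol r) → compose g X ≃ g
  compose-X     (poly [])             = ≃-refl
  compose-X {r} (poly ((a , e) ∷ ts)) = +P-cong monomial (compose-X (poly ts))
    where
    monomial : constP a *P ∏Fin r (λ i → X i ^P Vec.lookup e i) ≃ term (a , e)
    monomial = ≃-trans (*P-congʳ (constP a) (∏Fin-^P e))
                       (term-cong (*-identityʳ a) (VecP.zipWith-identityˡ ℕP.+-identityˡ e))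

  module _ {r : ℕ} where
    open import Algebra.Properties.Monoid.Sum (CommutativeRing.+-monoid (polynomialRing r)) using (sum)
    open import Algebra.Properties.Monoid.Sum (CommutativeRing.*-monoid (polynomialRing r))
      using () renaming (sum to ∏)

    ΣFin≃sum : ∀ k (F : Fin k → Pol r) → ΣFin k F ≃ sum F
    ΣFin≃sum zero    F = ≃-refl
    ΣFin≃sum (suc k) F = +P-cong (≃-refl {p = F Fin.zero}) (ΣFin≃sum k (F ∘ Fin.suc))

    ∏Fin≃∏ : ∀ k (F : Fin k → Pol r) → ∏Fin k F ≃ ∏ F
    ∏Fin≃∏ zero    F = ≃-refl
    ∏Fin≃∏ (suc k) F = *P-cong (≃-refl {p = F Fin.zero}) (∏Fin≃∏ k (F ∘ Fin.suc))

module PolynomialQuotient {c ℓ} (R : CommutativeRing c ℓ) {r k : ℕ} (h : Fin k → Poly {R = R} r) where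
  open PolynomialRing R
  open QuotientRing (polynomialRing r) h public using (_≡ᴵ_; ≡ᴵ-intro; ≈⇒≡ᴵ; generator≡ᴵ0#; quotientRing)
  open CommutativeRing quotientRing
  open import Algebra.Properties.Monoid.Sum +-monoid using (sum; sum-cong-≋; sum-replicate-zero)
  open import Relation.Binary.Reasoning.Setoid setoid
  open Multiplier commutativeSemiring

  ≡ᴵ⇒CongMod : ∀ {p q} → p ≡ᴵ q → CongMod k h p q
  ≡ᴵ⇒CongMod (≡ᴵ-intro (cs , p-q≃∑)) =
    cs , ≃⇒≈P (≃-trans p-q≃∑ (≃-sym (ΣFin≃sum k (λ i → cs i *P h i))))

  CongMod⇒≡ᴵ : ∀ {m} (ι : Fin m → Fin k) {p q} → CongMod m (h ∘ ι) p q → p ≡ᴵ q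
  CongMod⇒≡ᴵ {m} ι {p} {q} (cs , p-q≈∑) = x∙y⁻¹≈ε⇒x≈y p q (begin
    p - q
      ≈⟨ ≈⇒≡ᴵ (≃-trans (≈P⇒≃ p-q≈∑) (ΣFin≃sum m (λ j → cs j *P h (ι j)))) ⟩
    sum (λ j → cs j * h (ι j))
      ≈⟨ sum-cong-≋ {m} (λ j → trans (*-congˡ {cs j} (generator≡ᴵ0# (ι j))) (zeroʳ (cs j))) ⟩
    sum {m} (λ _ → 0#)
      ≈⟨ sum-replicate-zero m ⟩
    0#
      ∎)
    where open import Algebra.Properties.Group +-group using (x∙y⁻¹≈ε⇒x≈y)

  Balanced⇒≈[]-compose : ∀ {O} → Balanced X O → ∀ g (β : Fin r → Fin r) → g ≈[ O ] compose g (X ∘ β)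
  Balanced⇒≈[]-compose {O} bal g β = begin
    g *P O                   ≈⟨ ≈⇒≡ᴵ (*P-cong (≃-sym (compose-X g)) (≃-refl {p = O})) ⟩
    compose g X *P O         ≈⟨ compose-cong _≈[ O ]_ (λ {p} → refl {p *P O})
                                  (λ {p} {q} {p′} {q′} → ≈[]-+-cong O {p} {q} {p′} {q′})
                                  (λ {p} {q} {p′} {q′} → ≈[]-*-cong O {p} {q} {p′} {q′})
                                  g (λ i → bal i (β i)) ⟩
    compose g (X ∘ β) *P O   ∎

module WeilOperator {c ℓ} (R : CommutativeRing c ℓ) (n : ℕ) (a : Fin n → CommutativeRing.Carrier R) where
  open PolynomialRing R
  open import Data.Fin.Relation.Unary.Top using (view; ‵fromℕ; ‵inject₁)

  module Mod𝔣 (r : ℕ) where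
    open PolynomialQuotient R (fAt {r = r} n a) public
    open CommutativeRing quotientRing public
    open Multiplier commutativeSemiring public
    open import Relation.Binary.Reasoning.Setoid setoid public

  X≈[O2]X : ∀ {r} (i j : Fin r) → let open Mod𝔣 r in X i ≈[ O2 n a i j ] X j
  X≈[O2]X {r} i j = begin
    X i *P O2 n a i j                    ≈⟨ +-identityʳ _ ⟨
    X i *P O2 n a i j +P 0P              ≈⟨ +-congˡ (generator≡ᴵ0# j) ⟨
    X i *P O2 n a i j +P fAt n a j       ≈⟨ differenceQuotient-spec {X i} {varPow i} {X j} {varPow j}
                                                                    (powers i) (powers j) κ n ⟩
    X j *P O2 n a i j +P fAt n a i       ≈⟨ +-congˡ (generator≡ᴵ0# i) ⟩
    X j *P O2 n a i j +P 0P              ≈⟨ +-identityʳ _ ⟩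
    X j *P O2 n a i j                    ∎
    where
    open Mod𝔣 r
    open DifferenceQuotient commutativeSemiring using (IsPowerSequence; differenceQuotient-spec)
    powers : ∀ i → IsPowerSequence (X i) (varPow i)
    powers i = ≈⇒≡ᴵ (varPow-zero i) , λ k → ≈⇒≡ᴵ (varPow-suc i k)
    κ : ℕ → Poly r
    κ k = constP (fcoef n a k)

  ∏O2-Balanced : ∀ k → let open Mod𝔣 (suc k) in Balanced X (∏Fin k (λ j → O2 n a (inject₁ j) (fromℕ k)))
  ∏O2-Balanced k =
    Balanced-resp X (≈⇒≡ᴵ (≃-sym (∏Fin≃∏ k F))) (Balanced-intro X (∏ F) (X (fromℕ k)) to-last)
    where
    open Mod𝔣 (suc k)
    F : Fin k → Poly (suc k)
    F j = O2 n a (inject₁ j) (fromℕ k)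
    to-last : ∀ i → X i ≈[ ∏ F ] X (fromℕ k)
    to-last i with view i
    ... | ‵fromℕ     = refl
    ... | ‵inject₁ j = ≈[]-∏ (X ∘ inject₁) (X (fromℕ k)) F (λ j → X≈[O2]X (inject₁ j) (fromℕ k)) j

  IsWeilOp⇒Balanced : ∀ r {O} → IsWeilOp n a r O → let open Mod𝔣 r in Balanced X O
  IsWeilOp⇒Balanced zero (lift ())
  IsWeilOp⇒Balanced 1 _ Fin.zero Fin.zero = Mod𝔣.refl 1
  IsWeilOp⇒Balanced 2 (lift O≈O2) =
    Balanced-resp X (sym (≈⇒≡ᴵ (≈P⇒≃ O≈O2))) (Balanced-intro X (O2 n a Fin.zero x₁) (X x₁) to-x₁)
    where
    open Mod𝔣 2
    x₁ : Fin 2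
    x₁ = Fin.suc Fin.zero
    to-x₁ : ∀ i → X i ≈[ O2 n a Fin.zero x₁ ] X x₁
    to-x₁ Fin.zero           = X≈[O2]X Fin.zero x₁
    to-x₁ (Fin.suc Fin.zero) = refl
  IsWeilOp⇒Balanced (suc (suc (suc r))) (_ , O≡∏) =
    Balanced-resp X (sym (CongMod⇒≡ᴵ (λ _ → fromℕ (suc (suc r))) O≡∏)) (∏O2-Balanced (suc (suc r)))
    where open Mod𝔣 (suc (suc (suc r)))

proposition2p8 : ∀ {c ℓ : Level} (R : CommutativeRing c ℓ) → IsFiniteField R →
    (n : ℕ) → 1 ≤ n → (a : Fin n → CommutativeRing.Carrier R) →
    (r : ℕ) → 1 ≤ r → (g : Poly {R = R} r) → (β : Fin r → Fin r) →
    (O : Poly {R = R} r) → IsWeilOp n a r O →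
    CongMod r (fAt n a) (g *P O) (compose g (λ i → X (β i)) *P O)
proposition2p8 R _ n _ a r _ g β O weilOp =
  ≡ᴵ⇒CongMod (Balanced⇒≈[]-compose (IsWeilOp⇒Balanced r weilOp) g β)
  where
  open WeilOperator R n a
  open Mod𝔣 r
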